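{- There exists a countably infinite partially ordered set $\langle C,\le\rangle$ which is strongly dense but does not have the splitting property. Moreover, this poset can be chosen so that for all $x,y\in C$ with $x<y$ there is an infinite set $Z\subseteq (x,y)=\{z\in C: x<z<y\}$ such that any two distinct elements of $Z$ are incomparable.
   Context: Let $\langle P,\le\rangle$ be a partially ordered set; write $x<y$ for $x\le y$ and $x\neq y$. For $H\subseteq P$ let $\mathcal{D}(H)=\{x\in P:\exists s\in H,\ x\le s\}$ and $\mathcal{U}(H)=\{x\in P:\exists s\in H,\ x\ge s\}$. An antichain is a set of pairwise incomparable elements; an antichain $A$ is maximal if no antichain of $P$ properly contains it. An antichain $A$ splits if there is a partition $\{D,U\}$ of $A$ (into two disjoint sets, possibly empty, with union $A$) such that $P=\mathcal{D}(D)\cup\mathcal{U}(U)$. $P$ has the splitting property if every maximal antichain of $P$ splits. For $x<y$ the open interval is $(x,y)=\{z\in P: x<z<y\}$. $P$ is strongly dense if for every non-empty open interval $(x,y)$ of $P$ there are $z_1,z_2\in(x,y)$ that are incomparable (neither $z_1\le z_2$ nor $z_2\le z_1$). -}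

module Defs where

open import Level using (0ℓ)
open import Data.Nat using (ℕ)
open import Data.Product using (Σ; ∃; ∃-syntax; _×_; _,_)
open import Data.Sum using (_⊎_)
open import Data.Empty using (⊥)
open import Relation.Nullary using (¬_)
open import Relation.Unary using (Pred; _∈_; _∉_; _⊆_)
open import Relation.Binary.PropositionalEquality using (_≡_; _≢_)
open import Relation.Binary.Structures using (IsPartialOrder)
open import Function.Bundles using (_↔_)
open import Function.Definitions using (Injective)

module PosetNotions {C : Set} (_≤_ : C → C → Set) where

  _<_ : C → C → Set
  x < y = (x ≤ y) × (x ≢ y)

  Incomparable : C → C → Set
  Incomparable x y = ¬ (x ≤ y) × ¬ (y ≤ x)

  𝒟 : Pred C 0ℓ → Pred C 0ℓ
  𝒟 H x = ∃[ s ] (s ∈ H × x ≤ s)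

  𝒰 : Pred C 0ℓ → Pred C 0ℓ
  𝒰 H x = ∃[ s ] (s ∈ H × s ≤ x)

  Interval : C → C → Pred C 0ℓ
  Interval x y z = (x < z) × (z < y)

  IsAntichain : Pred C 0ℓ → Set
  IsAntichain A = ∀ a b → a ∈ A → b ∈ A → a ≢ b → Incomparable a b

  IsMaximalAntichain : Pred C 0ℓ → Set₁
  IsMaximalAntichain A =
    IsAntichain A ×
    ¬ (∃[ B ] (IsAntichain B × A ⊆ B × ∃[ b ] (b ∈ B × b ∉ A)))

  Splits : Pred C 0ℓ → Set₁
  Splits A = ∃[ D ] ∃[ U ]
    ( (∀ a → a ∈ A → (a ∈ D ⊎ a ∈ U))
    × D ⊆ A × U ⊆ A
    × (∀ a → a ∈ D → a ∈ U → ⊥)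
    × (∀ x → (x ∈ 𝒟 D ⊎ x ∈ 𝒰 U)) )

  SplittingProperty : Set₁
  SplittingProperty = ∀ A → IsMaximalAntichain A → Splits A

  StronglyDense : Set
  StronglyDense = ∀ x y → x < y → (∃[ z ] (z ∈ Interval x y)) →
    ∃[ z₁ ] ∃[ z₂ ] (z₁ ∈ Interval x y × z₂ ∈ Interval x y × Incomparable z₁ z₂)

  InfiniteAntichainsInIntervals : Set
  InfiniteAntichainsInIntervals = ∀ x y → x < y →
    Σ (ℕ → C) λ f → Injective _≡_ _≡_ f
      × (∀ n → f n ∈ Interval x y)
      × (∀ m n → f m ≢ f n → Incomparable (f m) (f n))

{-# OPTIONS --safe #-}
-- Order the nodes of the infinite binary tree by in-order traversal: a countable dense
-- linear order ⊏ in which the root has nodes on both sides. Blow every node except the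
-- root up into an infinite antichain, i.e. pick a map key whose fibres are infinite
-- except the fibre {root} of the root, and put x ≤ y iff x = y or key x ⊏ key y.
-- Between two nodes of the tree lies a whole blown-up node, which is an infinite
-- antichain inside the interval. The root is comparable with every element, so {root} is
-- a maximal antichain; it would split only if the root were the top or the bottom.
module Submission where

open import Defs
open import Level using (0ℓ)
open import Data.Nat using (ℕ; zero; suc)
open import Data.Nat.Properties using (0≢1+n)
open import Data.Nat.Binary using (ℕᵇ; 2[1+_]; 1+[2_]; toℕ; fromℕ)
  renaming (zero to 0ᵇ)
open import Data.Nat.Binary.Properties using (toℕ-fromℕ; fromℕ-toℕ)
open import Data.Bool using (Bool; true; false)
open import Data.List using (List; []; _∷_; _++_; _∷ʳ_; [_]; replicate; length)
open import Data.List.Properties using (++-cancelʳ; length-replicate)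
open import Data.Product using (Σ; ∃₂; ∃-syntax; _×_; _,_)
open import Data.Sum using (_⊎_; inj₁; inj₂)
import Data.Sum as Sum
open import Data.Empty using (⊥-elim)
open import Relation.Nullary using (¬_)
open import Relation.Unary using (_∈_; _∉_; _⊆_)
open import Relation.Binary.Core using (Rel)
open import Relation.Binary.Structures using (IsPartialOrder; IsStrictPartialOrder)
open import Relation.Binary.PropositionalEquality
  using (_≡_; _≢_; refl; sym; trans; cong; subst; resp₂; isEquivalence; module ≡-Reasoning)
open import Function.Base using (_∘_)
open import Function.Bundles using (_↔_; mk↔ₛ′)
open import Function.Definitions using (Injective)
open import Function.Properties.Inverse using (↔-trans)

module _ {C : Set} {_≤_ : Rel C 0ℓ} where
  open PosetNotions _≤_

  infiniteAntichains⇒stronglyDense : InfiniteAntichainsInIntervals → StronglyDense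
  infiniteAntichains⇒stronglyDense antichains x y x<y _
    with antichains x y x<y
  ... | f , f-injective , f∈ , f-antichain =
    f 0 , f 1 , f∈ 0 , f∈ 1 , f-antichain 0 1 (0≢1+n ∘ f-injective)

  module _ {c : C} where

    comparable⇒singleton-maximal : (∀ x → x ≢ c → x ≤ c ⊎ c ≤ x) →
                                   IsMaximalAntichain (_≡ c)
    comparable⇒singleton-maximal comparable =
      (λ a b a≡c b≡c a≢b → ⊥-elim (a≢b (trans a≡c (sym b≡c)))) , noLargerAntichain
      where
      noLargerAntichain : ¬ (∃[ B ] (IsAntichain B × (_≡ c) ⊆ B × ∃[ b ] (b ∈ B × b ∉ (_≡ c))))
      noLargerAntichain (B , B-antichain , c∈B⇐ , b , b∈B , b≢c)
        with B-antichain b c b∈B (c∈B⇐ refl) b≢c | comparable b b≢c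
      ... | b≰c , _   | inj₁ b≤c = b≰c b≤c
      ... | _   , c≰b | inj₂ c≤b = c≰b c≤b

    singleton-splits⇒extremal : Splits (_≡ c) → (∀ x → x ≤ c) ⊎ (∀ x → c ≤ x)
    singleton-splits⇒extremal (D , U , cover , D⊆ , U⊆ , disjoint , covers)
      with cover c refl
    ... | inj₁ c∈D = inj₁ below
      where
      below : ∀ x → x ≤ c
      below x with covers x
      ... | inj₁ (s , s∈D , x≤s) with D⊆ s∈D
      ...   | refl = x≤s
      below x | inj₂ (s , s∈U , _) with U⊆ s∈U
      ...   | refl = ⊥-elim (disjoint c c∈D s∈U)
    ... | inj₂ c∈U = inj₂ above
      where
      above : ∀ x → c ≤ x
      above x with covers x
      ... | inj₂ (s , s∈U , s≤x) with U⊆ s∈U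
      ...   | refl = s≤x
      above x | inj₁ (s , s∈D , _) with D⊆ s∈D
      ...   | refl = ⊥-elim (disjoint c s∈D c∈U)

    inner-singleton-¬splits : IsPartialOrder _≡_ _≤_ → ∀ {x y} → x < c → c < y →
                              ¬ Splits (_≡ c)
    inner-singleton-¬splits isPartialOrder {x} {y} (x≤c , x≢c) (c≤y , c≢y) splits =
      Sum.[ (λ below → c≢y (sym (antisym (below y) c≤y)))
          , (λ above → x≢c (antisym x≤c (above x)))
          ]′ (singleton-splits⇒extremal splits)
      where open IsPartialOrder isPartialOrder using (antisym)

module KeyedOrder {C L : Set} {_⊏_ : Rel L 0ℓ}
                  (⊏-isStrictPartialOrder : IsStrictPartialOrder _≡_ _⊏_)
                  (key : C → L) where
  open IsStrictPartialOrder ⊏-isStrictPartialOrder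
    using ()
    renaming (irrefl to ⊏-irrefl; trans to ⊏-trans; asym to ⊏-asym)

  _≤_ : Rel C 0ℓ
  x ≤ y = x ≡ y ⊎ key x ⊏ key y

  ≤-isPartialOrder : IsPartialOrder _≡_ _≤_
  ≤-isPartialOrder = record
    { isPreorder = record
      { isEquivalence = isEquivalence
      ; reflexive     = inj₁
      ; trans         = ≤-trans
      }
    ; antisym = ≤-antisym
    }
    where
    ≤-trans : ∀ {x y z} → x ≤ y → y ≤ z → x ≤ z
    ≤-trans (inj₁ refl) y≤z         = y≤z
    ≤-trans (inj₂ x⊏y)  (inj₁ refl) = inj₂ x⊏y
    ≤-trans (inj₂ x⊏y)  (inj₂ y⊏z)  = inj₂ (⊏-trans x⊏y y⊏z)

    ≤-antisym : ∀ {x y} → x ≤ y → y ≤ x → x ≡ y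
    ≤-antisym (inj₁ x≡y) _           = x≡y
    ≤-antisym (inj₂ _)   (inj₁ y≡x)  = sym y≡x
    ≤-antisym (inj₂ x⊏y) (inj₂ y⊏x)  = ⊥-elim (⊏-asym x⊏y y⊏x)

  open PosetNotions _≤_

  ⊏⇒< : ∀ {x y} → key x ⊏ key y → x < y
  ⊏⇒< kx⊏ky = inj₂ kx⊏ky , λ { refl → ⊏-irrefl refl kx⊏ky }

  <⇒⊏ : ∀ {x y} → x < y → key x ⊏ key y
  <⇒⊏ (inj₁ x≡y , x≢y) = ⊥-elim (x≢y x≡y)
  <⇒⊏ (inj₂ kx⊏ky , _) = kx⊏ky

  sameKey⇒incomparable : ∀ {x y} → key x ≡ key y → x ≢ y → Incomparable x y
  sameKey⇒incomparable kx≡ky x≢y =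
    Sum.[ x≢y , ⊏-irrefl kx≡ky ]′ , Sum.[ x≢y ∘ sym , ⊏-irrefl (sym kx≡ky) ]′

  InfiniteFibre : L → Set
  InfiniteFibre m = Σ (ℕ → C) λ f → Injective _≡_ _≡_ f × ∀ n → key (f n) ≡ m

  infiniteAntichainsInIntervals :
    (∀ {a b} → a ⊏ b → ∃[ m ] (a ⊏ m × m ⊏ b × InfiniteFibre m)) →
    InfiniteAntichainsInIntervals
  infiniteAntichainsInIntervals between x y x<y
    with between (<⇒⊏ x<y)
  ... | m , kx⊏m , m⊏ky , f , f-injective , key-f =
    f , f-injective ,
    (λ n → ⊏⇒< (subst (key x ⊏_) (sym (key-f n)) kx⊏m) ,
           ⊏⇒< (subst (_⊏ key y) (sym (key-f n)) m⊏ky)) ,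
    λ i j → sameKey⇒incomparable (trans (key-f i) (sym (key-f j)))

  singletonFibre⇒comparable : (∀ {a b} → a ≢ b → a ⊏ b ⊎ b ⊏ a) →
                              ∀ {c} → (∀ x → key x ≡ key c → x ≡ c) →
                              ∀ x → x ≢ c → x ≤ c ⊎ c ≤ x
  singletonFibre⇒comparable ⊏-connected fibre x x≢c =
    Sum.map inj₂ inj₂ (⊏-connected (x≢c ∘ fibre x))

-- A list is a path from the root of the binary tree (false = left), and ⊏ is the
-- in-order traversal: left subtree, then the root, then the right subtree.
infix 4 _⊏_

data _⊏_ : Rel (List Bool) 0ℓ where
  left⊏root  : ∀ {s}   → false ∷ s ⊏ []
  root⊏right : ∀ {t}   → [] ⊏ true ∷ t
  left⊏right : ∀ {s t} → false ∷ s ⊏ true ∷ t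
  ∷-mono     : ∀ {b s t} → s ⊏ t → b ∷ s ⊏ b ∷ t

⊏-irrefl : ∀ {s t} → s ≡ t → ¬ (s ⊏ t)
⊏-irrefl refl (∷-mono s⊏s) = ⊏-irrefl refl s⊏s

⊏-trans : ∀ {s t u} → s ⊏ t → t ⊏ u → s ⊏ u
⊏-trans left⊏root     root⊏right   = left⊏right
⊏-trans root⊏right    (∷-mono _)   = root⊏right
⊏-trans left⊏right    (∷-mono _)   = left⊏right
⊏-trans (∷-mono _)    left⊏root    = left⊏root
⊏-trans (∷-mono _)    left⊏right   = left⊏right
⊏-trans (∷-mono s⊏t)  (∷-mono t⊏u) = ∷-mono (⊏-trans s⊏t t⊏u)

⊏-isStrictPartialOrder : IsStrictPartialOrder _≡_ _⊏_
⊏-isStrictPartialOrder = record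
  { isEquivalence = isEquivalence
  ; irrefl        = ⊏-irrefl
  ; trans         = ⊏-trans
  ; <-resp-≈      = resp₂ _⊏_
  }

⊏-connected : ∀ {s t} → s ≢ t → s ⊏ t ⊎ t ⊏ s
⊏-connected {[]}        {[]}        []≢[] = ⊥-elim ([]≢[] refl)
⊏-connected {[]}        {false ∷ t} _     = inj₂ left⊏root
⊏-connected {[]}        {true ∷ t}  _     = inj₁ root⊏right
⊏-connected {false ∷ s} {[]}        _     = inj₁ left⊏root
⊏-connected {true ∷ s}  {[]}        _     = inj₂ root⊏right
⊏-connected {false ∷ s} {true ∷ t}  _     = inj₁ left⊏right
⊏-connected {true ∷ s}  {false ∷ t} _     = inj₂ left⊏right
⊏-connected {false ∷ s} {false ∷ t} s≢t   =
  Sum.map ∷-mono ∷-mono (⊏-connected (s≢t ∘ cong (false ∷_)))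
⊏-connected {true ∷ s}  {true ∷ t}  s≢t   =
  Sum.map ∷-mono ∷-mono (⊏-connected (s≢t ∘ cong (true ∷_)))

⊏-rightChild : ∀ s → s ⊏ s ∷ʳ true
⊏-rightChild []      = root⊏right
⊏-rightChild (b ∷ s) = ∷-mono (⊏-rightChild s)

leftChild-⊏ : ∀ s → s ∷ʳ false ⊏ s
leftChild-⊏ []      = left⊏root
leftChild-⊏ (b ∷ s) = ∷-mono (leftChild-⊏ s)

⊏-dense : ∀ {s t} → s ⊏ t → ∃₂ λ b u → s ⊏ b ∷ u × b ∷ u ⊏ t
⊏-dense (left⊏root {s})  = false , s ∷ʳ true  , ∷-mono (⊏-rightChild s) , left⊏root
⊏-dense (root⊏right {t}) = true  , t ∷ʳ false , root⊏right , ∷-mono (leftChild-⊏ t)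
⊏-dense (left⊏right {s}) = false , s ∷ʳ true  , ∷-mono (⊏-rightChild s) , left⊏right
⊏-dense (∷-mono {b} s⊏t) with ⊏-dense s⊏t
... | c , u , s⊏cu , cu⊏t = b , c ∷ u , ∷-mono s⊏cu , ∷-mono cu⊏t

-- key strips the leading falses and the first true, so every replicate n false ++ true ∷ u
-- lies in the fibre of a non-empty u; what is left over is sent to [ true ].
key : List Bool → List Bool
key []              = []
key (false ∷ [])    = [ true ]
key (false ∷ b ∷ s) = key (b ∷ s)
key (true ∷ [])     = [ true ]
key (true ∷ b ∷ s)  = b ∷ s

key-∷≢[] : ∀ b s → key (b ∷ s) ≢ []
key-∷≢[] false []      ()
key-∷≢[] false (c ∷ s) = key-∷≢[] c s
key-∷≢[] true  []      ()
key-∷≢[] true  (c ∷ s) ()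

key≡[]⇒≡[] : ∀ x → key x ≡ [] → x ≡ []
key≡[]⇒≡[] []      _      = refl
key≡[]⇒≡[] (b ∷ s) key≡[] = ⊥-elim (key-∷≢[] b s key≡[])

padded : List Bool → ℕ → List Bool
padded u n = replicate n false ++ true ∷ u

key-padded : ∀ b u n → key (padded (b ∷ u) n) ≡ b ∷ u
key-padded b u zero          = refl
key-padded b u (suc zero)    = refl
key-padded b u (suc (suc n)) = key-padded b u (suc n)

padded-injective : ∀ u → Injective _≡_ _≡_ (padded u)
padded-injective u {m} {n} pm≡pn = begin
  m                         ≡⟨ length-replicate m ⟨
  length (replicate m false) ≡⟨ cong length (++-cancelʳ (true ∷ u) _ _ pm≡pn) ⟩
  length (replicate n false) ≡⟨ length-replicate n ⟩
  n                         ∎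
  where open ≡-Reasoning

open KeyedOrder ⊏-isStrictPartialOrder key
open PosetNotions _≤_ using (_<_; InfiniteAntichainsInIntervals; IsMaximalAntichain)

⊏-dense-infiniteFibre : ∀ {s t} → s ⊏ t → ∃[ m ] (s ⊏ m × m ⊏ t × InfiniteFibre m)
⊏-dense-infiniteFibre s⊏t with ⊏-dense s⊏t
... | b , u , s⊏bu , bu⊏t =
  b ∷ u , s⊏bu , bu⊏t , padded (b ∷ u) , padded-injective (b ∷ u) , key-padded b u

List-Bool↔ℕᵇ : List Bool ↔ ℕᵇ
List-Bool↔ℕᵇ = mk↔ₛ′ toᵇ fromᵇ toᵇ-fromᵇ fromᵇ-toᵇ
  where
  toᵇ : List Bool → ℕᵇ
  toᵇ []          = 0ᵇ
  toᵇ (false ∷ s) = 1+[2 toᵇ s ]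
  toᵇ (true ∷ s)  = 2[1+ toᵇ s ]

  fromᵇ : ℕᵇ → List Bool
  fromᵇ 0ᵇ        = []
  fromᵇ 1+[2 n ]  = false ∷ fromᵇ n
  fromᵇ 2[1+ n ]  = true ∷ fromᵇ n

  toᵇ-fromᵇ : ∀ n → toᵇ (fromᵇ n) ≡ n
  toᵇ-fromᵇ 0ᵇ       = refl
  toᵇ-fromᵇ 1+[2 n ] = cong 1+[2_] (toᵇ-fromᵇ n)
  toᵇ-fromᵇ 2[1+ n ] = cong 2[1+_] (toᵇ-fromᵇ n)

  fromᵇ-toᵇ : ∀ s → fromᵇ (toᵇ s) ≡ s
  fromᵇ-toᵇ []          = refl
  fromᵇ-toᵇ (false ∷ s) = cong (false ∷_) (fromᵇ-toᵇ s)
  fromᵇ-toᵇ (true ∷ s)  = cong (true ∷_) (fromᵇ-toᵇ s)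

ℕᵇ↔ℕ : ℕᵇ ↔ ℕ
ℕᵇ↔ℕ = mk↔ₛ′ toℕ fromℕ toℕ-fromℕ fromℕ-toℕ

theorem2p2 : Σ Set λ C → Σ (C → C → Set) λ _≤_ →
    IsPartialOrder _≡_ _≤_
    × (C ↔ ℕ)
    × PosetNotions.StronglyDense _≤_
    × ¬ PosetNotions.SplittingProperty _≤_
    × PosetNotions.InfiniteAntichainsInIntervals _≤_
theorem2p2 =
  List Bool , _≤_ , ≤-isPartialOrder , ↔-trans List-Bool↔ℕᵇ ℕᵇ↔ℕ ,
  infiniteAntichains⇒stronglyDense antichains ,
  (λ splitting → inner-singleton-¬splits ≤-isPartialOrder below-root above-root
                   (splitting (_≡ []) root-maximal)) ,
  antichains
  where
  below-root : (true ∷ [ false ]) < []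
  below-root = ⊏⇒< left⊏root

  above-root : [] < [ true ]
  above-root = ⊏⇒< root⊏right

  antichains : InfiniteAntichainsInIntervals
  antichains = infiniteAntichainsInIntervals ⊏-dense-infiniteFibre

  root-maximal : IsMaximalAntichain (_≡ [])
  root-maximal = comparable⇒singleton-maximal
                   (singletonFibre⇒comparable ⊏-connected key≡[]⇒≡[])
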